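{- For every graph $H$ and every $n$, $h(n,H)=\mathrm{ex}(n,\mathcal{M}(H))$, where $\mathrm{ex}(n,\mathcal{M}(H))$ is the maximum number of edges of an $n$-vertex graph containing no member of $\mathcal{M}(H)$ as a subgraph.
   Context: For a graph $G$, let $F_{G,1}$ be the set of maps $f:E(G)\to E(G)$ with $f(e)\neq e$ for all $e\in E(G)$. A subgraph $G'$ is $f$-free if $f(e)\notin E(G')$ for all $e\in E(G')$. The quantity $h(n,H)$ is the maximum number of edges of an $n$-vertex graph $G$ for which some $f\in F_{G,1}$ exists such that $G$ contains no $f$-free copy of $H$. A graph $G$ is unavoidable for $H$ if for every $f\in F_{G,1}$ there is an $f$-free copy of $H$ in $G$. A graph $G$ is minimal unavoidable for $H$ if it is unavoidable for $H$ and no proper subgraph of it is. $\mathcal{M}(H)$ denotes the set of minimal unavoidable graphs for $H$.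
   Formalization: Members of $\mathcal{M}(H)$, the proper subgraphs tested for their minimality, and the n-vertex graphs in $\mathrm{ex}(n,\mathcal{M}(H))$ range only over graphs with no edge or at least two edges, so with $F_{G,1}$ nonempty. The statement above fails without it. -}

module Defs where

open import Data.Bool using (Bool; true; false; _∧_)
open import Data.Nat using (ℕ; _≤_; _<_)
open import Data.Fin using (Fin) renaming (_<_ to _<ᶠ_)
open import Data.Fin.Properties using () renaming (_<?_ to _<ᶠ?_)
open import Data.List using (List; length; filter; cartesianProduct; allFin)
open import Data.Product using (Σ; Σ-syntax; ∃; ∃-syntax; _×_; _,_; proj₁; proj₂)
open import Data.Sum using (_⊎_)
open import Relation.Nullary using (¬_; _×-dec_)
open import Relation.Nullary.Decidable using (does)
open import Relation.Binary.PropositionalEquality using (_≡_; _≢_)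
open import Data.Bool.Properties using () renaming (_≟_ to _≟ᵇ_)
open import Function.Definitions using (Injective)

record Graph (n : ℕ) : Set where
  field
    adj    : Fin n → Fin n → Bool
    sym    : ∀ i j → adj i j ≡ adj j i
    irrefl : ∀ i → adj i i ≡ false
open Graph public

-- Edges of G: unordered pairs {i,j}, represented canonically with i < j.
Edge : ∀ {n} → Graph n → Set
Edge {n} G = Σ[ i ∈ Fin n ] Σ[ j ∈ Fin n ] (i <ᶠ j × adj G i j ≡ true)

lo hi : ∀ {n} (G : Graph n) → Edge G → Fin n
lo G e = proj₁ e
hi G e = proj₁ (proj₂ e)

SameEdge : ∀ {n} (G : Graph n) → Edge G → Edge G → Set
SameEdge G e e' = (lo G e ≡ lo G e') × (hi G e ≡ hi G e')

edgeList : ∀ {n} → Graph n → List (Fin n × Fin n)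
edgeList {n} G =
  filter (λ p → (proj₁ p <ᶠ? proj₂ p) ×-dec (adj G (proj₁ p) (proj₂ p) ≟ᵇ true))
         (cartesianProduct (allFin n) (allFin n))

edgeCount : ∀ {n} → Graph n → ℕ
edgeCount G = length (edgeList G)

InF : ∀ {n} (G : Graph n) → (Edge G → Edge G) → Set
InF G f = ∀ e → ¬ SameEdge G (f e) e

record Copy {k n : ℕ} (H : Graph k) (G : Graph n) : Set where
  field
    φ     : Fin k → Fin n
    inj   : Injective _≡_ _≡_ φ
    hom   : ∀ u v → adj H u v ≡ true → adj G (φ u) (φ v) ≡ true
open Copy public

InCopy : ∀ {k n} {H : Graph k} {G : Graph n} → Copy H G → Edge G → Set
InCopy {k} {H = H} {G = G} c e =
  Σ[ u ∈ Fin k ] Σ[ v ∈ Fin k ] (adj H u v ≡ true × φ c u ≡ lo G e × φ c v ≡ hi G e)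

FFree : ∀ {k n} {H : Graph k} {G : Graph n} →
        (Edge G → Edge G) → Copy H G → Set
FFree f c = ∀ e → InCopy c e → ¬ InCopy c (f e)

-- Convention: only graphs G with F_{G,1} ≠ ∅ are considered,
-- i.e. graphs with no edge or at least two edges.
Admissible : ∀ {n} → Graph n → Set
Admissible G = Σ[ f ∈ (Edge G → Edge G) ] InF G f

Avoidable : ∀ {k n} → Graph k → Graph n → Set
Avoidable H G = Σ[ f ∈ (Edge G → Edge G) ] (InF G f × (∀ (c : Copy H G) → ¬ FFree f c))

Unavoidable : ∀ {k n} → Graph k → Graph n → Set
Unavoidable H G = ∀ (f : Edge G → Edge G) → InF G f → Σ[ c ∈ Copy H G ] FFree f c

ProperSub : ∀ {m n} → Graph m → Graph n → Set
ProperSub {m} {n} S G = Copy S G × (m < n ⊎ edgeCount S < edgeCount G)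

MinUnavoidable : ∀ {k n} → Graph k → Graph n → Set
MinUnavoidable H G =
  Admissible G × Unavoidable H G ×
  (∀ {m} (S : Graph m) → Admissible S → ProperSub S G → ¬ Unavoidable H S)

MFree : ∀ {k n} → Graph k → Graph n → Set
MFree H G = ∀ {m} (M : Graph m) → MinUnavoidable H M → ¬ Copy M G

IsMaxEdges : (n : ℕ) → (Graph n → Set) → ℕ → Set
IsMaxEdges n P m =
  (Σ[ G ∈ Graph n ] (P G × edgeCount G ≡ m)) × (∀ (G : Graph n) → P G → edgeCount G ≤ m)

IsH : ∀ {k} → ℕ → Graph k → ℕ → Set
IsH n H m = IsMaxEdges n (Avoidable H) m

-- ex(n, 𝓜(H)) = m   (host graphs admissible, per convention)
IsExM : ∀ {k} → ℕ → Graph k → ℕ → Set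
IsExM n H m = IsMaxEdges n (λ G → Admissible G × MFree H G) m

-- Avoidability of G for H is equivalent to G being admissible and containing
-- no member of 𝓜(H), so h(n,H) and ex(n,𝓜(H)) are maxima over the same graphs.
--
-- If f witnesses that G is avoidable and M ⊆ G is admissible, pull f back to
-- E(M), patching it by some map of F_{M,1} where f leaves E(M): every free copy
-- of H in M for the pulled-back map is f-free in G, so unavoidable graphs stay
-- unavoidable in admissible supergraphs and G contains no member of 𝓜(H).
-- Conversely, avoidability is decidable by exhaustive search over the finitely
-- many maps E(G) → E(G) and copies of H, so an admissible G that is not
-- avoidable is unavoidable; descending through proper admissible unavoidable
-- subgraphs, well-founded on (vertices, edges) ordered lexicographically,
-- reaches a member of 𝓜(H) inside G.
module Submission where

open import Defs
open import Data.Nat using (ℕ; zero; suc) renaming (_<_ to _<ℕ_)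
open import Data.Nat.Properties using (m≤n⇒m<n∨m≡n)
open import Data.Nat.Induction using (<-wellFounded)
open import Data.Bool using (true)
open import Data.Bool.Properties using () renaming (_≟_ to _≟ᵇ_)
open import Data.Fin using (Fin; combine; remQuot) renaming (_<_ to _<ᶠ_)
open import Data.Fin.Properties
  using (any?; all?; <-cmp; <-irrelevant; <-asym; injective⇒≤; remQuot-combine)
  renaming (_≟_ to _≟ᶠ_; _<?_ to _<ᶠ?_)
open import Data.Maybe as Maybe using (Maybe; just; nothing; fromMaybe)
open import Data.Vec using (Vec; []; _∷_; lookup; tabulate)
open import Data.Vec.Properties using (lookup∘tabulate)
open import Data.Product using (Σ; Σ-syntax; ∃; ∃-syntax; _×_; _,_; proj₁; proj₂; curry; uncurry)
open import Data.Product.Properties using (×-≡,≡→≡)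
open import Data.Product.Relation.Binary.Lex.Strict using (×-Lex; ×-wellFounded)
open import Data.Sum using (_⊎_; inj₁; inj₂; [_,_])
open import Function using (_∘_; id)
open import Function.Definitions using (Injective)
open import Induction.WellFounded using (Acc; acc)
open import Relation.Nullary using (¬_; Dec; yes; no; Irrelevant; contradiction)
open import Relation.Nullary.Decidable
  using (map′; ¬?; _×-dec_; _⊎-dec_; _→-dec_; decidable-stable; dec⇒maybe; dec-yes-irr)
open import Relation.Unary using (Decidable)
open import Relation.Binary using (DecidableEquality; tri<; tri≈; tri>)
open import Relation.Binary.PropositionalEquality using (_≡_; refl; trans; cong; subst; subst₂; _≗_)
import Relation.Binary.PropositionalEquality as ≡
open import Axiom.UniquenessOfIdentityProofs using (module Decidable⇒UIP)

private
  variable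
    A B C : Set
    k m n : ℕ

infix 4 _≐_
_≐_ : A × A → A × A → Set
(a , b) ≐ (c , d) = (a ≡ c × b ≡ d) ⊎ (a ≡ d × b ≡ c)

≐-sym : ∀ {a b c d : A} → (a , b) ≐ (c , d) → (c , d) ≐ (a , b)
≐-sym (inj₁ (refl , refl)) = inj₁ (refl , refl)
≐-sym (inj₂ (refl , refl)) = inj₂ (refl , refl)

≐-trans : ∀ {a b c d e f : A} → (a , b) ≐ (c , d) → (c , d) ≐ (e , f) → (a , b) ≐ (e , f)
≐-trans (inj₁ (refl , refl)) q                    = q
≐-trans (inj₂ (refl , refl)) (inj₁ (refl , refl)) = inj₂ (refl , refl)
≐-trans (inj₂ (refl , refl)) (inj₂ (refl , refl)) = inj₁ (refl , refl)

≐-cong : (g : A → B) → ∀ {a b c d : A} → (a , b) ≐ (c , d) → (g a , g b) ≐ (g c , g d)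
≐-cong g (inj₁ (refl , refl)) = inj₁ (refl , refl)
≐-cong g (inj₂ (refl , refl)) = inj₂ (refl , refl)

≐-cancel : {g : A → B} → Injective _≡_ _≡_ g →
           ∀ {a b c d : A} → (g a , g b) ≐ (g c , g d) → (a , b) ≐ (c , d)
≐-cancel g-inj (inj₁ (p , q)) = inj₁ (g-inj p , g-inj q)
≐-cancel g-inj (inj₂ (p , q)) = inj₂ (g-inj p , g-inj q)

Searchable : Set → Set₁
Searchable A = ∀ {P : A → Set} → Decidable P → Dec (∃ P)

searchable⇒∀? : Searchable A → {P : A → Set} → Decidable P → Dec (∀ x → P x)
searchable⇒∀? search P? =
  map′ (λ ¬∃¬ x → decidable-stable (P? x) (λ ¬p → ¬∃¬ (x , ¬p)))
       (λ ∀P (x , ¬p) → ¬p (∀P x))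
       (¬? (search (¬? ∘ P?)))

Maybe-searchable : Searchable A → Searchable (Maybe A)
Maybe-searchable search P? =
  map′ [ (nothing ,_) , (λ (a , p) → just a , p) ]
       (λ { (nothing , p) → inj₁ p ; (just a , p) → inj₂ (a , p) })
       (P? nothing ⊎-dec search (P? ∘ just))

Vec-searchable : Searchable A → ∀ n → Searchable (Vec A n)
Vec-searchable search zero    P? = map′ ([] ,_) (λ { ([] , p) → p }) (P? [])
Vec-searchable search (suc n) P? =
  map′ (λ (x , xs , p) → x ∷ xs , p) (λ { (x ∷ xs , p) → x , xs , p })
       (search (λ x → Vec-searchable search n (P? ∘ (x ∷_))))

Σ-searchable : {B : A → Set} → Searchable A → (∀ a → Searchable (B a)) → Searchable (Σ A B)
Σ-searchable searchA searchB P? =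
  map′ (λ (a , b , p) → (a , b) , p) (λ ((a , b) , p) → a , b , p)
       (searchA λ a → searchB a λ b → P? (a , b))

irrelevant-searchable : Dec A → Irrelevant A → Searchable A
irrelevant-searchable (no ¬a) _ _ = no (¬a ∘ proj₁)
irrelevant-searchable (yes a) irr {P} P? =
  map′ (a ,_) (λ (a' , p) → subst P (irr a' a) p) (P? a)

-- Without function extensionality a function space can only be searched for
-- predicates that respect pointwise equality.
ExtSearchable : Set → Set → Set₁
ExtSearchable A B =
  ∀ {P : (A → B) → Set} → (∀ {f g} → f ≗ g → P f → P g) → Decidable P → Dec (∃ P)

Fin-ext-searchable : Searchable B → ExtSearchable (Fin n) B
Fin-ext-searchable {n = n} search resp P? =
  map′ (λ (v , p) → lookup v , p)
       (λ (f , p) → tabulate f , resp (≡.sym ∘ lookup∘tabulate f) p)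
       (Vec-searchable search n (P? ∘ lookup))

ext-searchable-retract : (r : A → C) (s : C → A) → (∀ a → s (r a) ≡ a) →
                         ExtSearchable C B → ExtSearchable A B
ext-searchable-retract r s s∘r≡id search resp P? =
  map′ (λ (g , p) → g ∘ r , p)
       (λ (f , p) → f ∘ s , resp (λ a → cong f (≡.sym (s∘r≡id a))) p)
       (search (λ g≗g' → resp (g≗g' ∘ r)) (P? ∘ (_∘ r)))

Fin²-ext-searchable : Searchable B → ExtSearchable (Fin m × Fin n) B
Fin²-ext-searchable {n = n} search =
  ext-searchable-retract (uncurry combine) (remQuot n) (uncurry remQuot-combine)
                         (Fin-ext-searchable search)

module _ (G : Graph n) where

  IsEdge : Fin n → Fin n → Set
  IsEdge i j = i <ᶠ j × adj G i j ≡ true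

  IsEdge? : ∀ i j → Dec (IsEdge i j)
  IsEdge? i j = (i <ᶠ? j) ×-dec (adj G i j ≟ᵇ true)

  IsEdge-irrelevant : ∀ {i j} → Irrelevant (IsEdge i j)
  IsEdge-irrelevant (p , q) (p' , q') =
    ×-≡,≡→≡ (<-irrelevant p p' , Decidable⇒UIP.≡-irrelevant _≟ᵇ_ q q')

  ends : Edge G → Fin n × Fin n
  ends e = lo G e , hi G e

  edge-≡ : ∀ {e e'} → lo G e ≡ lo G e' → hi G e ≡ hi G e' → e ≡ e'
  edge-≡ {i , j , p} {.i , .j , p'} refl refl = cong (λ q → i , j , q) (IsEdge-irrelevant p p')

  ends-injective : ∀ {e e'} → ends e ≐ ends e' → e ≡ e'
  ends-injective (inj₁ (p , q)) = edge-≡ p q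
  ends-injective {_ , _ , i<j , _} {_ , _ , j<i , _} (inj₂ (refl , refl)) =
    contradiction j<i (<-asym i<j)

  infix 4 _≟ᵉ_
  _≟ᵉ_ : DecidableEquality (Edge G)
  e ≟ᵉ e' = map′ (uncurry edge-≡) (λ { refl → refl , refl })
                 ((lo G e ≟ᶠ lo G e') ×-dec (hi G e ≟ᶠ hi G e'))

  SameEdge⇒≡ : ∀ {e e'} → SameEdge G e e' → e ≡ e'
  SameEdge⇒≡ = uncurry edge-≡

  ≡⇒SameEdge : ∀ {e e'} → e ≡ e' → SameEdge G e e'
  ≡⇒SameEdge refl = refl , refl

  edge-adj : (e : Edge G) → adj G (lo G e) (hi G e) ≡ true
  edge-adj (_ , _ , _ , q) = q

  edgeBetween : ∀ {i j} → adj G i j ≡ true → Σ[ e ∈ Edge G ] ends e ≐ (i , j)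
  edgeBetween {i} {j} p with <-cmp i j
  ... | tri< i<j _ _  = (i , j , i<j , p) , inj₁ (refl , refl)
  ... | tri≈ _ refl _ = contradiction (trans (≡.sym p) (irrefl G i)) λ ()
  ... | tri> _ _ j<i  = (j , i , j<i , trans (Graph.sym G j i) p) , inj₂ (refl , refl)

  edge-searchable : Searchable (Edge G)
  edge-searchable =
    Σ-searchable any? λ i → Σ-searchable any? λ j →
      irrelevant-searchable (IsEdge? i j) IsEdge-irrelevant

  edgeAt : Fin n × Fin n → Maybe (Edge G)
  edgeAt (i , j) = Maybe.map (λ ij → i , j , ij) (dec⇒maybe (IsEdge? i j))

  edgeAt-ends : ∀ e → edgeAt (ends e) ≡ just e
  edgeAt-ends (i , j , ij) rewrite dec-yes-irr (IsEdge? i j) IsEdge-irrelevant ij = refl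

  -- A map E(G) → E(G) is encoded by a table on vertex pairs: entries at
  -- non-edges are ignored, and a missing entry at an edge means the identity.
  endomaps-ext-searchable : ExtSearchable (Edge G) (Edge G)
  endomaps-ext-searchable {P} resp P? =
    map′ (λ (t , p) → fromTable t , p)
         (λ (f , p) → toTable f , resp (fromTable∘toTable f) p)
         (Fin²-ext-searchable (Maybe-searchable edge-searchable)
            (λ t≗t' → resp λ e → cong (fromMaybe e) (t≗t' (ends e)))
            (P? ∘ fromTable))
    where
    fromTable : (Fin n × Fin n → Maybe (Edge G)) → Edge G → Edge G
    fromTable t e = fromMaybe e (t (ends e))

    toTable : (Edge G → Edge G) → Fin n × Fin n → Maybe (Edge G)
    toTable f = Maybe.map f ∘ edgeAt

    fromTable∘toTable : ∀ f → f ≗ fromTable (toTable f)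
    fromTable∘toTable f e rewrite edgeAt-ends e = refl

idᶜ : {G : Graph n} → Copy G G
idᶜ = record { φ = id ; inj = id ; hom = λ _ _ → id }

infixr 9 _∘ᶜ_
_∘ᶜ_ : {F : Graph k} {G : Graph m} {H : Graph n} → Copy G H → Copy F G → Copy F H
ψ ∘ᶜ χ = record
  { φ   = φ ψ ∘ φ χ
  ; inj = inj χ ∘ inj ψ
  ; hom = λ u v → hom ψ (φ χ u) (φ χ v) ∘ hom χ u v
  }

module _ {H : Graph k} {G : Graph n} where

  InCopy-≐ : (c : Copy H G) {e : Edge G} {u v : Fin k} → adj H u v ≡ true →
             ends G e ≐ (φ c u , φ c v) → InCopy c e
  InCopy-≐ c {u = u} {v} uv (inj₁ (p , q)) = u , v , uv , ≡.sym p , ≡.sym q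
  InCopy-≐ c {u = u} {v} uv (inj₂ (p , q)) =
    v , u , trans (Graph.sym H v u) uv , ≡.sym p , ≡.sym q

  InCopy-resp : {c c' : Copy H G} → φ c ≗ φ c' → ∀ {e} → InCopy c e → InCopy c' e
  InCopy-resp c≗c' (u , v , uv , p , q) =
    u , v , uv , trans (≡.sym (c≗c' u)) p , trans (≡.sym (c≗c' v)) q

  FFree-resp-copy : (f : Edge G → Edge G) (c c' : Copy H G) → φ c ≗ φ c' →
                    FFree f c → FFree f c'
  FFree-resp-copy f c c' c≗c' free e e∈ fe∈ = free e (back e e∈) (back (f e) fe∈)
    where
    back : ∀ e → InCopy c' e → InCopy c e
    back e = InCopy-resp {c'} {c} (≡.sym ∘ c≗c') {e}

  FFree-resp-map : ∀ {f g} {c : Copy H G} → f ≗ g → FFree f c → FFree g c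
  FFree-resp-map {f} {g} {c} f≗g free e e∈ ge∈ =
    free e e∈ (subst (InCopy c) (≡.sym (f≗g e)) ge∈)

  InCopy? : (c : Copy H G) → Decidable (InCopy c)
  InCopy? c e = any? λ u → any? λ v →
    (adj H u v ≟ᵇ true) ×-dec (φ c u ≟ᶠ lo G e) ×-dec (φ c v ≟ᶠ hi G e)

  FFree? : (f : Edge G → Edge G) (c : Copy H G) → Dec (FFree f c)
  FFree? f c = searchable⇒∀? (edge-searchable G) λ e →
    InCopy? c e →-dec ¬? (InCopy? c (f e))

  injective? : (g : Fin k → Fin n) → Dec (Injective _≡_ _≡_ g)
  injective? g = map′ (λ inj {x} {y} → inj x y) (λ inj x y → inj)
    (all? λ x → all? λ y → (g x ≟ᶠ g y) →-dec (x ≟ᶠ y))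

  homomorphic? : (g : Fin k → Fin n) →
                 Dec (∀ u v → adj H u v ≡ true → adj G (g u) (g v) ≡ true)
  homomorphic? g = all? λ u → all? λ v →
    (adj H u v ≟ᵇ true) →-dec (adj G (g u) (g v) ≟ᵇ true)

  reindex : (c : Copy H G) {g : Fin k → Fin n} → φ c ≗ g → Copy H G
  reindex c {g} c≗g = record
    { φ   = g
    ; inj = λ {x} {y} gx≡gy → inj c (trans (c≗g x) (trans gx≡gy (≡.sym (c≗g y))))
    ; hom = λ u v uv → subst₂ (λ x y → adj G x y ≡ true) (c≗g u) (c≗g v) (hom c u v uv)
    }

  copies-search : {P : Copy H G → Set} → (∀ c c' → φ c ≗ φ c' → P c → P c') →
                  Decidable P → Dec (∃ P)
  copies-search {P} resp P? =
    map′ (λ (_ , c , _ , p) → c , p) (λ (c , p) → φ c , c , (λ _ → refl) , p)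
         (Fin-ext-searchable any? resp-along along?)
    where
    Along : (Fin k → Fin n) → Set
    Along g = Σ[ c ∈ Copy H G ] (φ c ≗ g × P c)

    resp-along : ∀ {g g'} → g ≗ g' → Along g → Along g'
    resp-along g≗g' (c , c≗g , p) = c , (λ x → trans (c≗g x) (g≗g' x)) , p

    along? : Decidable Along
    along? g with injective? g | homomorphic? g
    ... | no ¬inj | _      = no λ (c , c≗g , _) → ¬inj (inj (reindex c c≗g))
    ... | yes _   | no ¬hom = no λ (c , c≗g , _) → ¬hom (hom (reindex c c≗g))
    ... | yes g-inj | yes g-hom =
      map′ (λ p → c₀ , (λ _ → refl) , p) (λ (c , c≗g , p) → resp c c₀ c≗g p) (P? c₀)
      where
      c₀ : Copy H G
      c₀ = record { φ = g ; inj = g-inj ; hom = g-hom }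

  freeCopy? : (f : Edge G → Edge G) → Dec (Σ (Copy H G) (FFree f))
  freeCopy? f = copies-search (FFree-resp-copy f) (FFree? f)

  avoidable? : Dec (Avoidable H G)
  avoidable? = endomaps-ext-searchable G resp λ f →
    inF? f ×-dec map′ curry uncurry (¬? (freeCopy? f))
    where
    inF? : (f : Edge G → Edge G) → Dec (InF G f)
    inF? f = searchable⇒∀? (edge-searchable G) λ e →
      ¬? ((lo G (f e) ≟ᶠ lo G e) ×-dec (hi G (f e) ≟ᶠ hi G e))

    resp : ∀ {f g} → f ≗ g → InF G f × (∀ c → ¬ FFree f c) → InF G g × (∀ c → ¬ FFree g c)
    resp f≗g (f∈F , none) =
      (λ e → f∈F e ∘ subst (λ x → SameEdge G x e) (≡.sym (f≗g e))) ,
      (λ c → none c ∘ FFree-resp-map {c = c} (≡.sym ∘ f≗g))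

  avoidable-or-unavoidable : Avoidable H G ⊎ Unavoidable H G
  avoidable-or-unavoidable with avoidable?
  ... | yes av = inj₁ av
  ... | no ¬av = inj₂ λ f f∈F →
    decidable-stable (freeCopy? f) λ ¬free → ¬av (f , f∈F , curry ¬free)

  avoidable⇒¬unavoidable : Avoidable H G → ¬ Unavoidable H G
  avoidable⇒¬unavoidable (f , f∈F , none) unavoidable = uncurry none (unavoidable f f∈F)

module Pullback (searchA : Searchable A) (_≟_ : DecidableEquality B)
                {ι : A → B} (ι-inj : Injective _≡_ _≡_ ι) (g : B → B) (d : A → A) where

  pullback : A → A
  pullback x with searchA (λ y → ι y ≟ g (ι x))
  ... | yes (y , _) = y
  ... | no _        = d x

  pullback-preimage : ∀ {x y} → ι y ≡ g (ι x) → pullback x ≡ y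
  pullback-preimage {x} {y} ιy≡ with searchA (λ y → ι y ≟ g (ι x))
  ... | yes (y' , ιy'≡) = ι-inj (trans ιy'≡ (≡.sym ιy≡))
  ... | no ¬pre         = contradiction (y , ιy≡) ¬pre

  pullback-cases : ∀ x → ι (pullback x) ≡ g (ι x) ⊎ pullback x ≡ d x
  pullback-cases x with searchA (λ y → ι y ≟ g (ι x))
  ... | yes (_ , ιy≡) = inj₁ ιy≡
  ... | no _          = inj₂ refl

module _ {M : Graph m} {G : Graph n} (ψ : Copy M G) where

  edgeMap : Edge M → Edge G
  edgeMap e = proj₁ (edgeBetween G (hom ψ (lo M e) (hi M e) (edge-adj M e)))

  edgeMap-ends : ∀ e → ends G (edgeMap e) ≐ (φ ψ (lo M e) , φ ψ (hi M e))
  edgeMap-ends e = proj₂ (edgeBetween G (hom ψ (lo M e) (hi M e) (edge-adj M e)))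

  edgeMap-injective : Injective _≡_ _≡_ edgeMap
  edgeMap-injective {e} {e'} ι-eq = ends-injective M {e} {e'} (≐-cancel (inj ψ) images)
    where
    images : (φ ψ (lo M e) , φ ψ (hi M e)) ≐ (φ ψ (lo M e') , φ ψ (hi M e'))
    images = ≐-trans (≐-sym (edgeMap-ends e))
      (subst (λ x → ends G x ≐ (φ ψ (lo M e') , φ ψ (hi M e'))) (≡.sym ι-eq) (edgeMap-ends e'))

  InCopy-lift : {H : Graph k} (c : Copy H M) → ∀ d → InCopy (ψ ∘ᶜ c) d →
                ∃[ e ] (edgeMap e ≡ d × InCopy c e)
  InCopy-lift c d (u , v , uv , p , q) =
    e , ends-injective G {edgeMap e} {d} e↦d , InCopy-≐ c {e} uv e-ends
    where
    e-between : Σ[ e ∈ Edge M ] ends M e ≐ (φ c u , φ c v)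
    e-between = edgeBetween M (hom c u v uv)

    e : Edge M
    e = proj₁ e-between

    e-ends : ends M e ≐ (φ c u , φ c v)
    e-ends = proj₂ e-between

    e↦d : ends G (edgeMap e) ≐ ends G d
    e↦d = ≐-trans (edgeMap-ends e) (≐-trans (≐-cong (φ ψ) e-ends) (inj₁ (p , q)))

unavoidable-mono : {H : Graph k} {M : Graph m} {G : Graph n} →
                   Admissible M → Copy M G → Unavoidable H M → Unavoidable H G
unavoidable-mono {H = H} {M} {G} (f₀ , f₀∈F) ψ M-unav f f∈F =
  let c , c-free = M-unav pullback pullback∈F in ψ ∘ᶜ c , lift-free c c-free
  where
  ι : Edge M → Edge G
  ι = edgeMap ψ

  open Pullback (edge-searchable M) (_≟ᵉ_ G) (edgeMap-injective ψ) f f₀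

  pullback∈F : InF M pullback
  pullback∈F e same with pullback-cases e
  ... | inj₁ ι-pb≡ = f∈F (ι e) (≡⇒SameEdge G {f (ι e)} {ι e} f-fixes-ιe)
    where
    f-fixes-ιe : f (ι e) ≡ ι e
    f-fixes-ιe = trans (≡.sym ι-pb≡) (cong ι (SameEdge⇒≡ M {pullback e} {e} same))
  ... | inj₂ pb≡f₀ = f₀∈F e (subst (λ x → SameEdge M x e) pb≡f₀ same)

  lift-free : (c : Copy H M) → FFree pullback c → FFree f (ψ ∘ᶜ c)
  lift-free c c-free d d∈ fd∈ with InCopy-lift ψ c d d∈ | InCopy-lift ψ c (f d) fd∈
  ... | e , ιe≡d , e∈ | e' , ιe'≡fd , e'∈ =
    c-free e e∈ (subst (InCopy c) (≡.sym pullback-e≡e') e'∈)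
    where
    pullback-e≡e' : pullback e ≡ e'
    pullback-e≡e' = pullback-preimage {e} {e'} (trans ιe'≡fd (cong f (≡.sym ιe≡d)))

_⊏_ : ℕ × ℕ → ℕ × ℕ → Set
_⊏_ = ×-Lex _≡_ _<ℕ_ _<ℕ_

size : Graph n → ℕ × ℕ
size {n} G = n , edgeCount G

ProperSub⇒⊏ : {S : Graph m} {G : Graph n} → ProperSub S G → size S ⊏ size G
ProperSub⇒⊏ (_ , inj₁ m<n) = inj₁ m<n
ProperSub⇒⊏ (S⊆G , inj₂ fewer-edges) with m≤n⇒m<n∨m≡n (injective⇒≤ (inj S⊆G))
... | inj₁ m<n  = inj₁ m<n
... | inj₂ refl = inj₂ (refl , fewer-edges)

module _ {H : Graph k} {G : Graph n} (G-free : MFree H G) where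

  -- Minimality of an unavoidable S ⊆ G is witnessed by the recursive call, so
  -- no decision about proper subgraphs is needed.
  unavoidable-subgraph-absurd : (S : Graph m) → Acc _⊏_ (size S) →
                                Admissible S → Copy S G → ¬ Unavoidable H S
  unavoidable-subgraph-absurd S (acc smaller) S-adm S⊆G S-unav =
    G-free S (S-adm , S-unav , minimal) S⊆G
    where
    minimal : ∀ {m'} (S' : Graph m') → Admissible S' → ProperSub S' S → ¬ Unavoidable H S'
    minimal S' S'-adm S'⊂S =
      unavoidable-subgraph-absurd S' (smaller (ProperSub⇒⊏ S'⊂S)) S'-adm (S⊆G ∘ᶜ proj₁ S'⊂S)

  MFree⇒¬unavoidable : Admissible G → ¬ Unavoidable H G
  MFree⇒¬unavoidable G-adm =
    unavoidable-subgraph-absurd G (×-wellFounded <-wellFounded <-wellFounded _) G-adm idᶜ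

module _ {H : Graph k} {G : Graph n} where

  avoidable⇒admissible×MFree : Avoidable H G → Admissible G × MFree H G
  avoidable⇒admissible×MFree av@(f , f∈F , _) =
    (f , f∈F) , λ M (M-adm , M-unav , _) M⊆G →
      avoidable⇒¬unavoidable av (unavoidable-mono M-adm M⊆G M-unav)

  admissible×MFree⇒avoidable : Admissible G × MFree H G → Avoidable H G
  admissible×MFree⇒avoidable (G-adm , G-free) with avoidable-or-unavoidable
  ... | inj₁ G-av   = G-av
  ... | inj₂ G-unav = contradiction G-unav (MFree⇒¬unavoidable G-free G-adm)

IsMaxEdges-resp : {P Q : Graph n → Set} → (∀ G → P G → Q G) → (∀ G → Q G → P G) →
                  ∀ {e} → IsMaxEdges n P e → IsMaxEdges n Q e
IsMaxEdges-resp P⇒Q Q⇒P ((G , PG , |G|≡e) , maximal) =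
  (G , P⇒Q G PG , |G|≡e) , λ G' QG' → maximal G' (Q⇒P G' QG')

proposition1p2 : ∀ {k : ℕ} (H : Graph k) (n m : ℕ) →
    (IsH n H m → IsExM n H m) × (IsExM n H m → IsH n H m)
proposition1p2 H n m =
  IsMaxEdges-resp (λ _ → avoidable⇒admissible×MFree) (λ _ → admissible×MFree⇒avoidable) ,
  IsMaxEdges-resp (λ _ → admissible×MFree⇒avoidable) (λ _ → avoidable⇒admissible×MFree)
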